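{- There exist infinitely many near-triangulations $G$ that have no vertex of degree $2$ and no bad 5-wheel, and satisfy $\gamma(G) = 2|V(G)|/7$.
   Context: A near-triangulation is a 2-connected plane graph in which every bounded face is bounded by a triangle; boundary vertices are those on the unbounded face. A bad 5-wheel in $G$ is a subgraph isomorphic to the 5-wheel (a 4-cycle plus a center adjacent to all four) whose 4-cycle contains two consecutive vertices that are both boundary vertices of $G$ of degree $3$ in $G$. $\gamma(G)$ is the minimum size of a dominating set of $G$. -}

module Defs where

open import Data.Nat using (ℕ; zero; suc; _+_; _*_; _≤_)
open import Data.Fin using (Fin; zero; suc)
open import Data.Fin.Properties using (_≟_)
open import Data.Fin.Subset using (Subset; _∈_; _∉_; ∣_∣)
open import Data.Unit using (⊤)
open import Data.Bool using (Bool; true; false)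
open import Data.Product using (Σ; ∃; ∃-syntax; _×_; _,_)
open import Data.Sum using (_⊎_)
open import Relation.Nullary using (¬_; Dec; yes; no)
open import Relation.Binary.PropositionalEquality using (_≡_; _≢_)

iter : ∀ {A : Set} → (A → A) → ℕ → A → A
iter f zero    x = x
iter f (suc k) x = f (iter f k x)

count : ∀ {d} {P : Fin d → Set} → (∀ x → Dec (P x)) → ℕ
count {zero}  P? = 0
count {suc d} P? with P? zero
... | yes _ = suc (count {d} (λ x → P? (suc x)))
... | no  _ = count {d} (λ x → P? (suc x))

-- Plane graphs, represented combinatorially by rotation systems
-- (combinatorial maps) of genus 0.
--
-- Vertices are Fin n, darts (half-edges) are Fin d.  tail x is the
-- vertex at which dart x starts, α pairs the two darts of an edge,
-- σ is the rotation (cyclic order of darts around each vertex).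
-- Faces are the orbits of φ = σ ∘ α, labelled by Fin f via `face`;
-- `outer` is the unbounded face.  Genus 0 (planarity of the
-- embedding) is Euler's formula  n - d/2 + f = 2  (the map is
-- connected: this is part of the near-triangulation condition).

record PlaneGraph : Set where
  field
    n d f      : ℕ
    tail       : Fin d → Fin n
    α σ        : Fin d → Fin d
    face       : Fin d → Fin f
    outer      : Fin f
    α-invol    : ∀ x → α (α x) ≡ x
    α-noFix    : ∀ x → α x ≢ x
    σ-inj      : ∀ x y → σ x ≡ σ y → x ≡ y
    σ-tail     : ∀ x → tail (σ x) ≡ tail x
    σ-orbit    : ∀ x y → tail x ≡ tail y → ∃[ k ] iter σ k x ≡ y
    face-φ     : ∀ x → face (σ (α x)) ≡ face x
    face-orbit : ∀ x y → face x ≡ face y → ∃[ k ] iter (λ z → σ (α z)) k x ≡ y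
    face-surj  : ∀ j → ∃[ x ] face x ≡ j
    noLoop     : ∀ x → tail (α x) ≢ tail x
    noMulti    : ∀ x y → tail x ≡ tail y → tail (α x) ≡ tail (α y) → x ≡ y
    euler      : 2 * n + 2 * f ≡ 4 + d

module _ (G : PlaneGraph) where
  open PlaneGraph G

  Adj : Fin n → Fin n → Set
  Adj u v = ∃[ x ] (tail x ≡ u × tail (α x) ≡ v)

  -- degree of a vertex (number of incident edges = number of neighbours,
  -- the graph being simple)
  deg : Fin n → ℕ
  deg v = count (λ x → tail x ≟ v)

  faceLength : Fin f → ℕ
  faceLength j = count (λ x → face x ≟ j)

  Boundary : Fin n → Set
  Boundary v = ∃[ x ] (face x ≡ outer × tail x ≡ v)

  data Walk (P : Fin n → Set) : Fin n → Fin n → Set where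
    here : ∀ {u} → P u → Walk P u u
    step : ∀ {u v w} → P u → Adj u v → Walk P v w → Walk P u w

  Connected : Set
  Connected = ∀ u v → Walk (λ _ → ⊤) u v

  TwoConnected : Set
  TwoConnected =
    3 ≤ n × Connected ×
    (∀ w u v → u ≢ w → v ≢ w → Walk (λ z → z ≢ w) u v)

  NearTriangulation : Set
  NearTriangulation = TwoConnected × (∀ j → j ≢ outer → faceLength j ≡ 3)

  -- a bad 5-wheel: distinct c, a, b, x, y with 4-cycle a b x y, center c
  -- adjacent to all four, and two consecutive cycle vertices a, b that are
  -- boundary vertices of degree 3 (any consecutive pair can be rotated to a b)
  BadFiveWheel : Set
  BadFiveWheel =
    Σ (Fin n) λ c → Σ (Fin n) λ a → Σ (Fin n) λ b → Σ (Fin n) λ x → Σ (Fin n) λ y →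
      (c ≢ a × c ≢ b × c ≢ x × c ≢ y × a ≢ b × a ≢ x × a ≢ y × b ≢ x × b ≢ y × x ≢ y) ×
      (Adj a b × Adj b x × Adj x y × Adj y a) ×
      (Adj c a × Adj c b × Adj c x × Adj c y) ×
      (Boundary a × deg a ≡ 3 × Boundary b × deg b ≡ 3)

  Dominating : Subset n → Set
  Dominating S = ∀ v → v ∈ S ⊎ ∃[ u ] (u ∈ S × Adj u v)

  IsDominationNumber : ℕ → Set
  IsDominationNumber k =
    (∃[ S ] (Dominating S × ∣ S ∣ ≡ k)) × (∀ S → Dominating S → k ≤ ∣ S ∣)

{-# OPTIONS --safe #-}
module Submission where

-- The graphs are chains of m + 1 copies of one block: the triangulation of the
-- sphere on 7 vertices with a face V W U removed, in which W has degree 3 and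
-- every other vertex degree at least 4.  The blocks are glued along their edges
-- U V into a fan around the vertex U of the first block.  The result is a
-- near-triangulation on 7 (m + 1) vertices of minimum degree 3 whose vertices of
-- degree 3 are the pairwise non-adjacent W's, so it has no bad 5-wheel.  The
-- five vertices of a block other than U and V have all their neighbours in the
-- block and no common closed neighbour, so a dominating set meets every block
-- at least twice, while two suitable vertices per block dominate: γ = 2 (m + 1).

open import Defs
open import Data.Bool using (true; false; T)
open import Data.Empty using (⊥-elim)
open import Data.Fin using (Fin; zero; suc; #_; toℕ; inject₁; fromℕ; combine)
open import Data.Fin.Properties using (_≟_; all?; any?; pigeonhole; toℕ-inject₁; +↔⊎; *↔×)
import Data.Fin.Properties as Fin
open import Data.Fin.Subset using (Subset; _∈_; ∣_∣)
open import Data.Fin.Subset.Properties using (anySubset?; _∈?_)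
open import Data.List using (List; []; _∷_; length; filter; allFin)
open import Data.List.Properties using (length-map)
open import Data.List.Membership.Propositional using () renaming (_∈_ to _∈ˡ_)
open import Data.List.Relation.Unary.All as All using (All)
import Data.List.Relation.Unary.All.Properties as All
open import Data.List.Relation.Unary.All.Properties using (all-filter)
open import Data.List.Relation.Unary.AllPairs using ([]; _∷_)
open import Data.List.Relation.Unary.Any using (here; there)
open import Data.List.Relation.Unary.Unique.Propositional using (Unique)
open import Data.List.Relation.Unary.Unique.Propositional.Properties using (map⁺; filter⁺; allFin⁺)
open import Data.Maybe using (Maybe; just; nothing; is-just; _<∣>_; to-witness-T)
import Data.Maybe as Maybe
open import Data.Nat using (ℕ; zero; suc; _+_; _*_; _∸_; _≤_; _<_; z≤n; s≤s; _≤?_; _<?_)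
open import Data.Nat.Properties
  using (≤-refl; ≤-trans; <⇒≱; ≮⇒≥; m≤n⇒m≤1+n; +-suc; +-mono-≤; n<1+n; n≤1+n; m∸n+n≡m; m≤m*n;
         m≤n⇒∃[o]m+o≡n; suc-injective; 1+n≢n)
open import Data.Nat.Tactic.RingSolver using (solve-∀)
open import Data.Product using (Σ; ∃-syntax; _×_; _,_; proj₁; proj₂)
open import Data.Product.Function.NonDependent.Propositional using (_×-↔_)
open import Data.Product.Properties using (≡-dec)
open import Data.Sum using (_⊎_; inj₁; inj₂)
open import Data.Sum.Function.Propositional using (_⊎-↔_)
open import Data.Unit using (⊤; tt)
open import Data.Vec using (Vec; []; _∷_; _++_; concat; replicate; lookup; group)
open import Data.Vec.Properties using (lookup-concat; lookup-replicate; []=⇒lookup; lookup⇒[]=)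
open import Function using (_∘_; _∘₂_; _↔_; mk↔ₛ′; Inverse)
open import Function.Properties.Inverse using (↔-refl; ↔-trans)
open import Relation.Nullary using (¬_; Dec; yes; no; contradiction)
open import Relation.Nullary.Decidable using (from-yes; from-no; ¬?; _×-dec_; _⊎-dec_; _→-dec_; T?)
open import Relation.Binary.PropositionalEquality
  using (_≡_; _≢_; refl; sym; trans; cong; cong₂; subst; subst₂; module ≡-Reasoning)

open ≡-Reasoning

count-cong : ∀ {d} {P Q : Fin d → Set} (P? : ∀ x → Dec (P x)) (Q? : ∀ x → Dec (Q x)) →
  (∀ x → P x → Q x) → (∀ x → Q x → P x) → count P? ≡ count Q?
count-cong {zero}  P? Q? to from = refl
count-cong {suc d} P? Q? to from with P? zero | Q? zero
... | yes p | yes q = cong suc (count-cong (P? ∘ suc) (Q? ∘ suc) (to ∘ suc) (from ∘ suc))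
... | yes p | no ¬q = contradiction (to zero p) ¬q
... | no ¬p | yes q = contradiction (from zero q) ¬p
... | no ¬p | no ¬q = count-cong (P? ∘ suc) (Q? ∘ suc) (to ∘ suc) (from ∘ suc)

count-mono : ∀ {d} {P Q : Fin d → Set} (P? : ∀ x → Dec (P x)) (Q? : ∀ x → Dec (Q x)) →
  (∀ x → P x → Q x) → count P? ≤ count Q?
count-mono {zero}  P? Q? P⇒Q = z≤n
count-mono {suc d} P? Q? P⇒Q with P? zero | Q? zero
... | yes p | yes q = s≤s (count-mono (P? ∘ suc) (Q? ∘ suc) (P⇒Q ∘ suc))
... | yes p | no ¬q = contradiction (P⇒Q zero p) ¬q
... | no ¬p | yes q = m≤n⇒m≤1+n (count-mono (P? ∘ suc) (Q? ∘ suc) (P⇒Q ∘ suc))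
... | no ¬p | no ¬q = count-mono (P? ∘ suc) (Q? ∘ suc) (P⇒Q ∘ suc)

count-none : ∀ {d} {P : Fin d → Set} (P? : ∀ x → Dec (P x)) → (∀ x → ¬ P x) → count P? ≡ 0
count-none {zero}  P? ¬P = refl
count-none {suc d} P? ¬P with P? zero
... | yes p = contradiction p (¬P zero)
... | no _  = count-none (P? ∘ suc) (¬P ∘ suc)

count-disjoint-⊎ : ∀ {d} {P Q : Fin d → Set} (P? : ∀ x → Dec (P x)) (Q? : ∀ x → Dec (Q x)) →
  (∀ x → P x → ¬ Q x) → count (λ x → P? x ⊎-dec Q? x) ≡ count P? + count Q?
count-disjoint-⊎ {zero}  P? Q? disj = refl
count-disjoint-⊎ {suc d} P? Q? disj with P? zero | Q? zero
... | yes p | yes q = contradiction q (disj zero p)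
... | yes p | no _  = cong suc (count-disjoint-⊎ (P? ∘ suc) (Q? ∘ suc) (disj ∘ suc))
... | no _  | yes q = trans (cong suc (count-disjoint-⊎ (P? ∘ suc) (Q? ∘ suc) (disj ∘ suc))) (sym (+-suc _ _))
... | no _  | no _  = count-disjoint-⊎ (P? ∘ suc) (Q? ∘ suc) (disj ∘ suc)

count-≟ : ∀ {d} (a : Fin d) → count (_≟ a) ≡ 1
count-≟ {suc d} zero    = cong suc (count-none {d} (λ x → suc x ≟ zero) (λ x ()))
count-≟ {suc d} (suc a) =
  trans (count-cong (λ x → suc x ≟ suc a) (_≟ a) (λ x → Fin.suc-injective) (λ x → cong suc)) (count-≟ a)

module _ {d : ℕ} where

  open import Data.List.Membership.DecPropositional (_≟_ {d}) using () renaming (_∈?_ to _∈ˡ?_)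

  count-∈ : ∀ {xs : List (Fin d)} → Unique xs → count (_∈ˡ? xs) ≡ length xs
  count-∈ {[]}     []           = count-none (_∈ˡ? []) (λ x ())
  count-∈ {a ∷ xs} (a∉xs ∷ uxs) = begin
    count (_∈ˡ? a ∷ xs)                     ≡⟨ count-cong (_∈ˡ? a ∷ xs) (λ x → x ≟ a ⊎-dec x ∈ˡ? xs) split join ⟩
    count (λ x → (x ≟ a) ⊎-dec (x ∈ˡ? xs)) ≡⟨ count-disjoint-⊎ (_≟ a) (_∈ˡ? xs) a∉ ⟩
    count (_≟ a) + count (_∈ˡ? xs)         ≡⟨ cong₂ _+_ (count-≟ a) (count-∈ uxs) ⟩
    suc (length xs)                        ∎
    where
    a∉ : ∀ x → x ≡ a → ¬ x ∈ˡ xs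
    a∉ x refl x∈xs = All.lookup a∉xs x∈xs refl
    split : ∀ x → x ∈ˡ a ∷ xs → x ≡ a ⊎ x ∈ˡ xs
    split x (here x≡a)   = inj₁ x≡a
    split x (there x∈xs) = inj₂ x∈xs
    join : ∀ x → x ≡ a ⊎ x ∈ˡ xs → x ∈ˡ a ∷ xs
    join x (inj₁ x≡a)  = here x≡a
    join x (inj₂ x∈xs) = there x∈xs

  module _ {P : Fin d → Set} (P? : ∀ x → Dec (P x)) {xs : List (Fin d)} (uxs : Unique xs) where

    length≤count : All P xs → length xs ≤ count P?
    length≤count Pxs = subst (_≤ count P?) (count-∈ uxs) (count-mono (_∈ˡ? xs) P? (λ x → All.lookup Pxs))

    count≡length : All P xs → (∀ x → P x → x ∈ˡ xs) → count P? ≡ length xs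
    count≡length Pxs complete = trans (count-cong P? (_∈ˡ? xs) complete (λ x → All.lookup Pxs)) (count-∈ uxs)

module _ {A : Set} (f : A → A) where

  iter-+ : ∀ m n x → iter f (m + n) x ≡ iter f m (iter f n x)
  iter-+ zero    n x = refl
  iter-+ (suc m) n x = cong f (iter-+ m n x)

  iter-commute : ∀ k x → iter f k (f x) ≡ f (iter f k x)
  iter-commute zero    x = refl
  iter-commute (suc k) x = cong f (iter-commute k x)

  iter-*-period : ∀ p x → iter f p x ≡ x → ∀ t → iter f (t * p) x ≡ x
  iter-*-period p x fix zero    = refl
  iter-*-period p x fix (suc t) = begin
    iter f (p + t * p) x       ≡⟨ iter-+ p (t * p) x ⟩
    iter f p (iter f (t * p) x) ≡⟨ cong (iter f p) (iter-*-period p x fix t) ⟩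
    iter f p x                 ≡⟨ fix ⟩
    x                          ∎

  Reachable : A → A → Set
  Reachable x y = ∃[ k ] iter f k x ≡ y

  reachable-refl : ∀ {x} → Reachable x x
  reachable-refl = 0 , refl

  reachable-step : ∀ {x y} → Reachable (f x) y → Reachable x y
  reachable-step {x} (k , fx⟶y) = suc k , trans (sym (iter-commute k x)) fx⟶y

  reachable-trans : ∀ {x y z} → Reachable x y → Reachable y z → Reachable x z
  reachable-trans {x} (a , x⟶y) (b , y⟶z) = b + a , trans (iter-+ b a x) (trans (cong (iter f b) x⟶y) y⟶z)

iter-cong : ∀ {A : Set} {f g : A → A} → (∀ x → f x ≡ g x) → ∀ k x → iter f k x ≡ iter g k x
iter-cong f≗g zero    x = refl
iter-cong {g = g} f≗g (suc k) x = trans (f≗g _) (cong g (iter-cong f≗g k x))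

module _ {A B : Set} (to : A → B) (from : B → A) (to∘from : ∀ b → to (from b) ≡ b) (f : B → B) where

  iter-conjugate : ∀ k b → iter (from ∘ f ∘ to) k (from b) ≡ from (iter f k b)
  iter-conjugate zero    b = refl
  iter-conjugate (suc k) b = cong (from ∘ f) (trans (cong to (iter-conjugate k b)) (to∘from _))

  reachable-conjugate : ∀ {b b'} → Reachable f b b' → Reachable (from ∘ f ∘ to) (from b) (from b')
  reachable-conjugate {b} (k , b⟶b') = k , trans (iter-conjugate k b) (cong from b⟶b')

module _ {d : ℕ} (f : Fin d → Fin d) (f-inj : ∀ x y → f x ≡ f y → x ≡ y) where

  iter-injective : ∀ k x y → iter f k x ≡ iter f k y → x ≡ y
  iter-injective zero    x y eq = eq
  iter-injective (suc k) x y eq = iter-injective k x y (f-inj _ _ eq)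

  iter-periodic : ∀ x → ∃[ p ] iter f (suc p) x ≡ x
  iter-periodic x with pigeonhole (n<1+n d) (λ i → iter f (toℕ i) x)
  ... | i , j , i<j , eq with m≤n⇒∃[o]m+o≡n i<j
  ...   | p , i+1+p≡j = p , sym (iter-injective (toℕ i) x _ (begin
    iter f (toℕ i) x                ≡⟨ eq ⟩
    iter f (toℕ j) x                ≡⟨ cong (λ k → iter f k x) (sym i+1+p≡j) ⟩
    iter f (suc (toℕ i) + p) x      ≡⟨ cong (λ k → iter f k x) (sym (+-suc (toℕ i) p)) ⟩
    iter f (toℕ i + suc p) x        ≡⟨ iter-+ f (toℕ i) (suc p) x ⟩
    iter f (toℕ i) (iter f (suc p) x) ∎))

  -- With y = fᵏ x and f^(p+1) x = x, the step count k (p + 1) ∸ k leads from y back to x.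
  reachable-sym : ∀ {x y} → Reachable f x y → Reachable f y x
  reachable-sym {x} (k , refl) with iter-periodic x
  ... | p , cycle = k * suc p ∸ k , (begin
    iter f (k * suc p ∸ k) (iter f k x) ≡⟨ sym (iter-+ f (k * suc p ∸ k) k x) ⟩
    iter f (k * suc p ∸ k + k) x        ≡⟨ cong (λ n → iter f n x) (m∸n+n≡m (m≤m*n k (suc p))) ⟩
    iter f (k * suc p) x                ≡⟨ iter-*-period f (suc p) x cycle k ⟩
    x                                   ∎)

module _ {A : Set} (Good : A → Set) (f : A → A) where

  Along : ℕ → A → Set
  Along zero    a = ⊤
  Along (suc k) a = Along k a × Good (iter f k a)

  along? : (∀ a → Dec (Good a)) → ∀ k a → Dec (Along k a)
  along? good? zero    a = yes tt
  along? good? (suc k) a = along? good? k a ×-dec good? (iter f k a)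

  iter-along : ∀ {B : Set} (embed : A → B) (g : B → B) → (∀ a → Good a → g (embed a) ≡ embed (f a)) →
    ∀ k a → Along k a → iter g k (embed a) ≡ embed (iter f k a)
  iter-along embed g commute zero    a _              = refl
  iter-along embed g commute (suc k) a (along , good) =
    trans (cong g (iter-along embed g commute k a along)) (commute _ good)

module _ (G : PlaneGraph) where
  open PlaneGraph G

  φ : Fin d → Fin d
  φ x = σ (α x)

  length≤deg : ∀ {v xs} → Unique xs → All (λ x → tail x ≡ v) xs → length xs ≤ deg G v
  length≤deg {v} uxs = length≤count (λ x → tail x ≟ v) uxs

  φ-noFix : ∀ x → φ x ≢ x
  φ-noFix x φx≡x = noLoop x (trans (sym (σ-tail (α x))) (cong tail φx≡x))

  private
    iter3-cases : ∀ {r} → iter φ 3 r ≡ r → ∀ k → iter φ k r ∈ˡ r ∷ φ r ∷ φ (φ r) ∷ []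
    iter3-cases cycle zero = here refl
    iter3-cases cycle (suc k) with iter3-cases cycle k
    ... | here eq                 = there (here (cong φ eq))
    ... | there (here eq)         = there (there (here (cong φ eq)))
    ... | there (there (here eq)) = here (trans (cong φ eq) cycle)

  faceLength≡3 : ∀ {r j} → face r ≡ j → iter φ 3 r ≡ r → faceLength G j ≡ 3
  faceLength≡3 {r} {j} refl cycle =
    count≡length (λ x → face x ≟ face r) distinct
      (refl All.∷ face-φ r All.∷ trans (face-φ (φ r)) (face-φ r) All.∷ All.[])
      (λ x fx≡fr → let (k , r⟶x) = face-orbit r x (sym fx≡fr) in subst (_∈ˡ _) r⟶x (iter3-cases cycle k))
    where
    distinct : Unique (r ∷ φ r ∷ φ (φ r) ∷ [])
    distinct = (φ-noFix r ∘ sym All.∷ (λ r≡φφr → φ-noFix r (trans (cong φ r≡φφr) cycle)) All.∷ All.[])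
             ∷ (φ-noFix (φ r) ∘ sym All.∷ All.[])
             ∷ (All.[] ∷ [])

module _ {G : PlaneGraph} where
  open PlaneGraph G

  Adj-sym : ∀ {u v} → Adj G u v → Adj G v u
  Adj-sym (x , tx≡u , tαx≡v) = α x , tαx≡v , trans (cong tail (α-invol x)) tx≡u

  module _ {P : Fin n → Set} where

    _++ʷ_ : ∀ {u v w} → Walk G P u v → Walk G P v w → Walk G P u w
    here _       ++ʷ q = q
    step p a r   ++ʷ q = step p a (r ++ʷ q)

    walk-start : ∀ {u v} → Walk G P u v → P u
    walk-start (here p)     = p
    walk-start (step p _ _) = p

    reverseʷ : ∀ {u v} → Walk G P u v → Walk G P v u
    reverseʷ (here p)     = here p
    reverseʷ (step p a r) = reverseʷ r ++ʷ step (walk-start r) (Adj-sym a) (here p)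

  mapʷ : ∀ {P Q : Fin n → Set} → (∀ {z} → P z → Q z) → ∀ {u v} → Walk G P u v → Walk G Q u v
  mapʷ P⇒Q (here p)     = here (P⇒Q p)
  mapʷ P⇒Q (step p a r) = step (P⇒Q p) a (mapʷ P⇒Q r)

third-element : ∀ {k} → 3 ≤ k → (u v : Fin k) → ∃[ w ] (u ≢ w × v ≢ w)
third-element (s≤s (s≤s (s≤s _))) u v with u ≟ zero | v ≟ zero
... | no u≢0   | no v≢0 = zero , u≢0 , v≢0
... | yes refl | _ with v ≟ suc zero
...   | no v≢1   = suc zero , (λ ()) , v≢1
...   | yes refl = suc (suc zero) , (λ ()) , (λ ())
third-element (s≤s (s≤s (s≤s _))) u v | no u≢0 | yes refl with u ≟ suc zero
... | no u≢1   = suc zero , u≢1 , (λ ())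
... | yes refl = suc (suc zero) , (λ ()) , (λ ())

module _ (G : PlaneGraph) where
  open PlaneGraph G

  AvoidingWalks : Set
  AvoidingWalks = ∀ w u v → u ≢ w → v ≢ w → Walk G (_≢ w) u v

  avoidingWalks⇒connected : 3 ≤ n → AvoidingWalks → Connected G
  avoidingWalks⇒connected 3≤n avoid u v =
    let (w , u≢w , v≢w) = third-element 3≤n u v in mapʷ (λ _ → tt) (avoid w u v u≢w v≢w)

  twoConnected : 3 ≤ n → AvoidingWalks → TwoConnected G
  twoConnected 3≤n avoid = 3≤n , avoidingWalks⇒connected 3≤n avoid , avoid

-- The orbit conditions of PlaneGraph are certified by representatives: every
-- dart reaches the representative of its vertex (face).  On a finite type the
-- permutation σ (σ ∘ α) can also be followed back, which gives the orbits.
record PlaneMap (V D F : Set) : Set where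
  field
    tail                : D → V
    α σ σ⁻¹             : D → D
    face                : D → F
    outer               : F
    vertexRep           : V → D
    faceRep             : F → D
    α-invol             : ∀ x → α (α x) ≡ x
    α-noFix             : ∀ x → α x ≢ x
    σ⁻¹-σ               : ∀ x → σ⁻¹ (σ x) ≡ x
    σ-tail              : ∀ x → tail (σ x) ≡ tail x
    vertexRep-reachable : ∀ x → Reachable σ x (vertexRep (tail x))
    face-φ              : ∀ x → face (σ (α x)) ≡ face x
    faceRep-reachable   : ∀ x → Reachable (σ ∘ α) x (faceRep (face x))
    face-faceRep        : ∀ j → face (faceRep j) ≡ j
    noLoop              : ∀ x → tail (α x) ≢ tail x
    noMulti             : ∀ x y → tail x ≡ tail y → tail (α x) ≡ tail (α y) → x ≡ y

module Enumerated {V D F : Set} (M : PlaneMap V D F) {n d f : ℕ}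
                  (V↔ : Fin n ↔ V) (D↔ : Fin d ↔ D) (F↔ : Fin f ↔ F) where

  open PlaneMap M
  open Inverse V↔ public using () renaming (to to vertexAt; from to vertexIndex;
    strictlyInverseˡ to vertexAt-index; strictlyInverseʳ to index-vertexAt)
  open Inverse D↔ using () renaming (to to dartAt; from to dartIndex;
    strictlyInverseˡ to dartAt-index; strictlyInverseʳ to index-dartAt)
  open Inverse F↔ using () renaming (to to faceAt; from to faceIndex; strictlyInverseʳ to index-faceAt)

  private
    indexed : (D → D) → Fin d → Fin d
    indexed g = dartIndex ∘ g ∘ dartAt

    index-injective : ∀ {A : Set} {k} (A↔ : Fin k ↔ A) {a b} → Inverse.from A↔ a ≡ Inverse.from A↔ b → a ≡ b
    index-injective A↔ {a} {b} eq =
      trans (sym (Inverse.strictlyInverseˡ A↔ a)) (trans (cong (Inverse.to A↔) eq) (Inverse.strictlyInverseˡ A↔ b))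

    dartAt-injective : ∀ {x y} → dartAt x ≡ dartAt y → x ≡ y
    dartAt-injective {x} {y} eq = trans (sym (index-dartAt x)) (trans (cong dartIndex eq) (index-dartAt y))

    tail-indexed : ∀ g x → vertexIndex (tail (dartAt (indexed g x))) ≡ vertexIndex (tail (g (dartAt x)))
    tail-indexed g x = cong (vertexIndex ∘ tail) (dartAt-index _)

    φ-indexed : ∀ x → indexed σ (indexed α x) ≡ indexed (σ ∘ α) x
    φ-indexed x = cong (dartIndex ∘ σ) (dartAt-index _)

    face-faceRep-indexed : ∀ j → faceIndex (face (dartAt (dartIndex (faceRep (faceAt j))))) ≡ j
    face-faceRep-indexed j =
      trans (cong (faceIndex ∘ face) (dartAt-index _)) (trans (cong faceIndex (face-faceRep _)) (index-faceAt j))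

    reachable-indexed : ∀ g x {c} → Reachable g (dartAt x) c → Reachable (indexed g) x (dartIndex c)
    reachable-indexed g x reach = subst (λ y → Reachable (indexed g) y _) (index-dartAt x)
                                        (reachable-conjugate dartAt dartIndex dartAt-index g reach)

    orbit : ∀ (g : D → D) → (∀ x y → g x ≡ g y → x ≡ y) → ∀ {B : Set} (key : D → B) (rep : B → D) →
      (∀ x → Reachable g x (rep (key x))) →
      ∀ x y → key (dartAt x) ≡ key (dartAt y) → Reachable (indexed g) x y
    orbit g g-inj key rep reach x y same =
      reachable-trans (indexed g) (reachable-indexed g x (reach (dartAt x)))
        (subst (λ b → Reachable (indexed g) (dartIndex (rep b)) y) (sym same)
          (reachable-sym (indexed g) indexed-inj (reachable-indexed g y (reach (dartAt y)))))
      where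
      indexed-inj : ∀ x y → indexed g x ≡ indexed g y → x ≡ y
      indexed-inj x y eq = dartAt-injective (g-inj _ _ (index-injective D↔ eq))

    σ-inj : ∀ x y → σ x ≡ σ y → x ≡ y
    σ-inj x y eq = trans (sym (σ⁻¹-σ x)) (trans (cong σ⁻¹ eq) (σ⁻¹-σ y))

    φ-inj : ∀ x y → σ (α x) ≡ σ (α y) → x ≡ y
    φ-inj x y eq = trans (sym (α-invol x)) (trans (cong α (σ-inj _ _ eq)) (α-invol y))

  module _ (euler : 2 * n + 2 * f ≡ 4 + d) where

    toPlaneGraph : PlaneGraph
    toPlaneGraph = record
      { n = n ; d = d ; f = f
      ; tail    = vertexIndex ∘ tail ∘ dartAt
      ; α       = indexed α
      ; σ       = indexed σ
      ; face    = faceIndex ∘ face ∘ dartAt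
      ; outer   = faceIndex outer
      ; α-invol = λ x → trans (cong (dartIndex ∘ α) (dartAt-index _))
                              (trans (cong dartIndex (α-invol _)) (index-dartAt x))
      ; α-noFix = λ x eq → α-noFix (dartAt x) (trans (sym (dartAt-index _)) (cong dartAt eq))
      ; σ-inj   = λ x y eq → dartAt-injective (σ-inj _ _ (index-injective D↔ eq))
      ; σ-tail  = λ x → trans (tail-indexed σ x) (cong vertexIndex (σ-tail _))
      ; σ-orbit = λ x y same → orbit σ σ-inj tail vertexRep vertexRep-reachable x y (index-injective V↔ same)
      ; face-φ  = λ x → trans (cong (faceIndex ∘ face ∘ dartAt) (φ-indexed x))
                             (trans (cong (faceIndex ∘ face) (dartAt-index _)) (cong faceIndex (face-φ _)))
      ; face-orbit = λ x y same →
          let (k , x⟶y) = orbit (σ ∘ α) φ-inj face faceRep faceRep-reachable x y (index-injective F↔ same)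
          in k , trans (iter-cong φ-indexed k x) x⟶y
      ; face-surj = λ j → dartIndex (faceRep (faceAt j)) , face-faceRep-indexed j
      ; noLoop  = λ x eq → noLoop (dartAt x) (index-injective V↔ (trans (sym (tail-indexed α x)) eq))
      ; noMulti = λ x y eq eqα → dartAt-injective (noMulti _ _ (index-injective V↔ eq)
          (index-injective V↔ (trans (sym (tail-indexed α x)) (trans eqα (tail-indexed α y)))))
      ; euler   = euler
      }

    private
      G = toPlaneGraph

    Adj-dart : ∀ c → Adj G (vertexIndex (tail c)) (vertexIndex (tail (α c)))
    Adj-dart c = dartIndex c , cong (vertexIndex ∘ tail) (dartAt-index c) ,
      trans (tail-indexed α (dartIndex c)) (cong (vertexIndex ∘ tail ∘ α) (dartAt-index c))

    Adj⇒dart : ∀ {u v} → Adj G u v → ∃[ c ] (tail c ≡ vertexAt u × tail (α c) ≡ vertexAt v)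
    Adj⇒dart (x , refl , refl) =
      dartAt x , sym (vertexAt-index _) , trans (cong tail (sym (dartAt-index _))) (sym (vertexAt-index _))

    darts≤deg : ∀ {v xs} → Unique xs → All (λ c → tail c ≡ v) xs → length xs ≤ deg G (vertexIndex v)
    darts≤deg {v} {xs} uxs tails = subst (_≤ deg G (vertexIndex v)) (length-map dartIndex xs)
      (length≤deg G (map⁺ (index-injective D↔) uxs) (All.map⁺ (All.map tail-index tails)))
      where
      tail-index : ∀ {c} → tail c ≡ v → PlaneGraph.tail G (dartIndex c) ≡ vertexIndex v
      tail-index {c} tc≡v = trans (cong (vertexIndex ∘ tail) (dartAt-index c)) (cong vertexIndex tc≡v)

    triangulated : (∀ j → j ≢ outer → iter (σ ∘ α) 3 (faceRep j) ≡ faceRep j) →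
      ∀ j → j ≢ PlaneGraph.outer G → faceLength G j ≡ 3
    triangulated cycle j j≢outer = faceLength≡3 G (face-faceRep-indexed j)
      (trans (iter-cong φ-indexed 3 _) (trans (iter-conjugate dartAt dartIndex dartAt-index (σ ∘ α) 3 _)
        (cong dartIndex (cycle (faceAt j) (j≢outer ∘ trans (sym (index-faceAt j)) ∘ cong faceIndex)))))

∣++∣ : ∀ {a b} (xs : Subset a) (ys : Subset b) → ∣ xs ++ ys ∣ ≡ ∣ xs ∣ + ∣ ys ∣
∣++∣ []           ys = refl
∣++∣ (true ∷ xs)  ys = cong suc (∣++∣ xs ys)
∣++∣ (false ∷ xs) ys = ∣++∣ xs ys

∣concat-replicate∣ : ∀ {c} k (p : Subset c) → ∣ concat (replicate k p) ∣ ≡ k * ∣ p ∣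
∣concat-replicate∣ zero    p = refl
∣concat-replicate∣ (suc k) p = trans (∣++∣ p _) (cong (∣ p ∣ +_) (∣concat-replicate∣ k p))

*≤∣concat∣ : ∀ {k c t} (ps : Vec (Subset c) k) →
  (∀ i → t ≤ ∣ lookup ps i ∣) → k * t ≤ ∣ concat ps ∣
*≤∣concat∣ []       large = z≤n
*≤∣concat∣ (p ∷ ps) large = subst (_ ≤_) (sym (∣++∣ p (concat ps)))
  (+-mono-≤ (large zero) (*≤∣concat∣ ps (large ∘ suc)))

∈-concat⁺ : ∀ {k c} (ps : Vec (Subset c) k) i x → x ∈ lookup ps i → combine i x ∈ concat ps
∈-concat⁺ ps i x x∈p = lookup⇒[]= (combine i x) (concat ps) (trans (lookup-concat ps i x) ([]=⇒lookup x∈p))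

∈-concat⁻ : ∀ {k c} (ps : Vec (Subset c) k) i x → combine i x ∈ concat ps → x ∈ lookup ps i
∈-concat⁻ ps i x ix∈ = lookup⇒[]= x (lookup ps i) (trans (sym (lookup-concat ps i x)) ([]=⇒lookup ix∈))

-- The triangulation of the sphere on the vertices 0 … 6 minus its face V W U,
-- as a rotation system on Fin 30: darts are numbered by their tail, blockσ
-- cycles through the darts at a vertex and blockα pairs the darts of an edge.
-- blockFace labels the nine triangles; the darts V → W, W → U of the removed
-- face lie on the outer face of the chain (rim), U → V on a fan triangle (spine).

U V W : Fin 7
U = # 6
V = # 3
W = # 4

blockTail : Fin 30 → Fin 7
blockTail = lookup (# 0 ∷ # 0 ∷ # 0 ∷ # 0 ∷ # 1 ∷ # 1 ∷ # 1 ∷ # 1 ∷ # 1 ∷ # 2 ∷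
                    # 2 ∷ # 2 ∷ # 2 ∷ # 3 ∷ # 3 ∷ # 3 ∷ # 3 ∷ # 3 ∷ # 4 ∷ # 4 ∷
                    # 4 ∷ # 5 ∷ # 5 ∷ # 5 ∷ # 5 ∷ # 6 ∷ # 6 ∷ # 6 ∷ # 6 ∷ # 6 ∷ [])

blockα : Fin 30 → Fin 30
blockα = lookup (# 23 ∷ # 15 ∷ # 6 ∷ # 11 ∷ # 28 ∷ # 12 ∷ # 2 ∷ # 14 ∷ # 19 ∷ # 27 ∷
                 # 24 ∷ # 3 ∷ # 5 ∷ # 20 ∷ # 7 ∷ # 1 ∷ # 22 ∷ # 25 ∷ # 29 ∷ # 8 ∷
                 # 13 ∷ # 26 ∷ # 16 ∷ # 0 ∷ # 10 ∷ # 17 ∷ # 21 ∷ # 9 ∷ # 4 ∷ # 18 ∷ [])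

blockσ : Fin 30 → Fin 30
blockσ = lookup (# 1 ∷ # 2 ∷ # 3 ∷ # 0 ∷ # 5 ∷ # 6 ∷ # 7 ∷ # 8 ∷ # 4 ∷ # 10 ∷
                 # 11 ∷ # 12 ∷ # 9 ∷ # 14 ∷ # 15 ∷ # 16 ∷ # 17 ∷ # 13 ∷ # 19 ∷ # 20 ∷
                 # 18 ∷ # 22 ∷ # 23 ∷ # 24 ∷ # 21 ∷ # 26 ∷ # 27 ∷ # 28 ∷ # 29 ∷ # 25 ∷ [])

blockσ⁻¹ : Fin 30 → Fin 30
blockσ⁻¹ = lookup (# 3 ∷ # 0 ∷ # 1 ∷ # 2 ∷ # 8 ∷ # 4 ∷ # 5 ∷ # 6 ∷ # 7 ∷ # 12 ∷
                   # 9 ∷ # 10 ∷ # 11 ∷ # 17 ∷ # 13 ∷ # 14 ∷ # 15 ∷ # 16 ∷ # 20 ∷ # 18 ∷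
                   # 19 ∷ # 24 ∷ # 21 ∷ # 22 ∷ # 23 ∷ # 29 ∷ # 25 ∷ # 26 ∷ # 27 ∷ # 28 ∷ [])

blockφ : Fin 30 → Fin 30
blockφ = blockσ ∘ blockα

-- The removed face consists of vToW, wToU and uToV.  In the chain the links
-- at U are inserted between uToW and uToV, those at V between vToU and vToW.
uToW vToU uToV vToW wToU : Fin 30
uToW = # 29
vToU = # 17
uToV = # 25
vToW = # 13
wToU = # 18

-- U and V are represented by uToW and vToU: within a block, the rotation
-- reaches them before it reaches the links of the chain.
blockVertexRep : Fin 7 → Fin 30
blockVertexRep = lookup (# 0 ∷ # 4 ∷ # 9 ∷ # 17 ∷ # 18 ∷ # 21 ∷ # 29 ∷ [])

data BlockFace : Set where
  triangle : Fin 9 → BlockFace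
  rim      : BlockFace
  spine    : BlockFace

blockFace : Fin 30 → BlockFace
blockFace = lookup (t (# 0) ∷ t (# 1) ∷ t (# 2) ∷ t (# 3) ∷ t (# 4) ∷ t (# 5) ∷ t (# 3) ∷ t (# 2) ∷
                    t (# 6) ∷ t (# 5) ∷ t (# 7) ∷ t (# 0) ∷ t (# 3) ∷ rim ∷ t (# 6) ∷ t (# 2) ∷
                    t (# 1) ∷ t (# 8) ∷ rim ∷ t (# 4) ∷ t (# 6) ∷ t (# 7) ∷ t (# 8) ∷ t (# 1) ∷
                    t (# 0) ∷ spine ∷ t (# 8) ∷ t (# 7) ∷ t (# 5) ∷ t (# 4) ∷ [])
  where t = triangle

blockTriangleRep : Fin 9 → Fin 30
blockTriangleRep = lookup (# 0 ∷ # 1 ∷ # 2 ∷ # 3 ∷ # 4 ∷ # 5 ∷ # 8 ∷ # 10 ∷ # 17 ∷ [])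

triangle-injective : ∀ {s t} → triangle s ≡ triangle t → s ≡ t
triangle-injective refl = refl

_≟ᶠ_ : (a b : BlockFace) → Dec (a ≡ b)
triangle s ≟ᶠ triangle t with s ≟ t
... | yes refl = yes refl
... | no s≢t   = no (s≢t ∘ triangle-injective)
triangle _ ≟ᶠ rim        = no λ ()
triangle _ ≟ᶠ spine      = no λ ()
rim        ≟ᶠ triangle _ = no λ ()
rim        ≟ᶠ rim        = yes refl
rim        ≟ᶠ spine      = no λ ()
spine      ≟ᶠ triangle _ = no λ ()
spine      ≟ᶠ rim        = no λ ()
spine      ≟ᶠ spine      = yes refl

Plain : Fin 30 → Set
Plain j = j ≢ uToW × j ≢ vToU

plain? : ∀ j → Dec (Plain j)
plain? j = ¬? (j ≟ uToW) ×-dec ¬? (j ≟ vToU)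

localDegree : Fin 7 → ℕ
localDegree x = length (filter (λ j → blockTail j ≟ x) (allFin 30))

BlockAdj : Fin 7 → Fin 7 → Set
BlockAdj x y = ∃[ j ] (blockTail j ≡ x × blockTail (blockα j) ≡ y)

blockAdj? : ∀ x y → Dec (BlockAdj x y)
blockAdj? x y = any? λ j → blockTail j ≟ x ×-dec blockTail (blockα j) ≟ y

Interior : Fin 7 → Set
Interior y = y ≢ U × y ≢ V

interior? : ∀ y → Dec (Interior y)
interior? y = ¬? (y ≟ U) ×-dec ¬? (y ≟ V)

DominatesInBlock : Subset 7 → Fin 7 → Set
DominatesInBlock c y = ∃[ x ] (x ∈ c × (x ≡ y ⊎ BlockAdj x y))

dominatesInBlock? : ∀ c y → Dec (DominatesInBlock c y)
dominatesInBlock? c y = any? λ x → x ∈? c ×-dec (x ≟ y ⊎-dec blockAdj? x y)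

blockDominator : Subset 7
blockDominator = false ∷ true ∷ true ∷ false ∷ false ∷ false ∷ false ∷ []

data BlockWalk (Ok : Fin 7 → Set) (y : Fin 7) : Fin 7 → Set where
  arrived : BlockWalk Ok y y
  via     : ∀ j → Ok (blockTail (blockα j)) → BlockWalk Ok y (blockTail (blockα j)) → BlockWalk Ok y (blockTail j)

firstJust : ∀ {A : Set} {k} → (Fin k → Maybe A) → Maybe A
firstJust {k = zero}  g = nothing
firstJust {k = suc k} g = g zero <∣> firstJust (g ∘ suc)

module _ {Ok : Fin 7 → Set} (ok? : ∀ x → Dec (Ok x)) (y : Fin 7) where

  searchWalk : ℕ → ∀ x → Maybe (BlockWalk Ok y x)
  searchWalk fuel x with x ≟ y
  ... | yes refl = just arrived
  searchWalk zero       x | no _ = nothing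
  searchWalk (suc fuel) x | no _ = firstJust stepVia
    where
    stepVia : Fin 30 → Maybe (BlockWalk Ok y x)
    stepVia j with blockTail j ≟ x | ok? (blockTail (blockα j))
    ... | yes refl | yes ok = Maybe.map (via j ok) (searchWalk fuel (blockTail (blockα j)))
    ... | _        | _      = nothing

foundWalk : ∀ {Ok : Fin 7 → Set} (ok? : ∀ x → Dec (Ok x)) y x →
  T (is-just (searchWalk ok? y 3 x)) → BlockWalk Ok y x
foundWalk ok? y x = to-witness-T (searchWalk ok? y 3 x)

-- Each fact below is decided by exhaustive computation, which abstract keeps
-- from being re-run wherever the fact is used.

abstract

  blockα-invol : ∀ j → blockα (blockα j) ≡ j
  blockα-invol = from-yes (all? λ j → blockα (blockα j) ≟ j)

  blockα-noFix : ∀ j → blockα j ≢ j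
  blockα-noFix = from-yes (all? λ j → ¬? (blockα j ≟ j))

  blockNoLoop : ∀ j → blockTail (blockα j) ≢ blockTail j
  blockNoLoop = from-yes (all? λ j → ¬? (blockTail (blockα j) ≟ blockTail j))

  blockNoMulti : ∀ j j′ → blockTail j ≡ blockTail j′ →
    blockTail (blockα j) ≡ blockTail (blockα j′) → j ≡ j′
  blockNoMulti = from-yes (all? λ j → all? λ j′ →
    blockTail j ≟ blockTail j′ →-dec blockTail (blockα j) ≟ blockTail (blockα j′) →-dec j ≟ j′)

  blockσ-tail : ∀ j → blockTail (blockσ j) ≡ blockTail j
  blockσ-tail = from-yes (all? λ j → blockTail (blockσ j) ≟ blockTail j)

  blockσ⁻¹-σ : ∀ j → blockσ⁻¹ (blockσ j) ≡ j
  blockσ⁻¹-σ = from-yes (all? λ j → blockσ⁻¹ (blockσ j) ≟ j)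

  blockFace-φ : ∀ j → Plain (blockα j) → blockFace (blockφ j) ≡ blockFace j
  blockFace-φ = from-yes (all? λ j → plain? (blockα j) →-dec blockFace (blockφ j) ≟ᶠ blockFace j)

  blockFace-triangleRep : ∀ t → blockFace (blockTriangleRep t) ≡ triangle t
  blockFace-triangleRep = from-yes (all? λ t → blockFace (blockTriangleRep t) ≟ᶠ triangle t)

  rim-darts : ∀ j → blockFace j ≡ rim → j ≡ vToW ⊎ j ≡ wToU
  rim-darts = from-yes (all? λ j → blockFace j ≟ᶠ rim →-dec (j ≟ vToW ⊎-dec j ≟ wToU))

  spine-dart : ∀ j → blockFace j ≡ spine → j ≡ uToV
  spine-dart = from-yes (all? λ j → blockFace j ≟ᶠ spine →-dec j ≟ uToV)

  W-independent : ∀ j → blockTail j ≡ W → blockTail (blockα j) ≢ W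
  W-independent = from-yes (all? λ j → blockTail j ≟ W →-dec ¬? (blockTail (blockα j) ≟ W))

  blockVertexRep-reachable : ∀ j → Σ (Fin 5) λ k →
    Along Plain blockσ (toℕ k) j × iter blockσ (toℕ k) j ≡ blockVertexRep (blockTail j)
  blockVertexRep-reachable = from-yes (all? λ j → any? λ (k : Fin 5) →
    along? Plain blockσ plain? (toℕ k) j ×-dec iter blockσ (toℕ k) j ≟ blockVertexRep (blockTail j))

  blockTriangleRep-reachable : ∀ j t → blockFace j ≡ triangle t → Σ (Fin 3) λ k →
    Along (Plain ∘ blockα) blockφ (toℕ k) j × iter blockφ (toℕ k) j ≡ blockTriangleRep t
  blockTriangleRep-reachable = from-yes (all? λ j → all? λ t →
    blockFace j ≟ᶠ triangle t →-dec any? λ (k : Fin 3) →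
      along? (Plain ∘ blockα) blockφ (plain? ∘ blockα) (toℕ k) j ×-dec iter blockφ (toℕ k) j ≟ blockTriangleRep t)

  blockTriangle-cycle : ∀ t →
    Along (Plain ∘ blockα) blockφ 3 (blockTriangleRep t) × iter blockφ 3 (blockTriangleRep t) ≡ blockTriangleRep t
  blockTriangle-cycle = from-yes (all? λ t →
    along? (Plain ∘ blockα) blockφ (plain? ∘ blockα) 3 (blockTriangleRep t) ×-dec
    iter blockφ 3 (blockTriangleRep t) ≟ blockTriangleRep t)

  3≤localDegree : ∀ x → 3 ≤ localDegree x
  3≤localDegree = from-yes (all? λ x → 3 ≤? localDegree x)

  4≤localDegree : ∀ x → x ≢ W → 4 ≤ localDegree x
  4≤localDegree = from-yes (all? λ x → ¬? (x ≟ W) →-dec 4 ≤? localDegree x)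

  blockDominator-dominates : ∀ y → DominatesInBlock blockDominator y
  blockDominator-dominates = from-yes (all? (dominatesInBlock? blockDominator))

  -- The five interior vertices have no common closed neighbour.
  interior-domination-needs-two : ∀ c → (∀ y → Interior y → DominatesInBlock c y) → 2 ≤ ∣ c ∣
  interior-domination-needs-two c dom = ≮⇒≥ (λ small → no-single-dominator (c , dom , small))
    where
    no-single-dominator : ¬ (∃[ c ] ((∀ y → Interior y → DominatesInBlock c y) × ∣ c ∣ < 2))
    no-single-dominator = from-no (anySubset? λ c →
      (all? λ y → interior? y →-dec dominatesInBlock? c y) ×-dec ∣ c ∣ <? 2)

  walkToU : ∀ x → BlockWalk (λ _ → ⊤) U x
  walkToU x = foundWalk (λ _ → yes tt) U x
    (from-yes (all? λ x → T? (is-just (searchWalk (λ _ → yes tt) U 3 x))) x)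

  walkToU-avoiding : ∀ r x → r ≢ U → x ≢ r → BlockWalk (_≢ r) U x
  walkToU-avoiding r x = foundWalk (λ z → ¬? (z ≟ r)) U x ∘₂
    from-yes (all? λ r → all? λ x → ¬? (r ≟ U) →-dec ¬? (x ≟ r) →-dec
                                     T? (is-just (searchWalk (λ z → ¬? (z ≟ r)) U 3 x))) r x

  walkToV-avoidingU : ∀ x → x ≢ U → BlockWalk (_≢ U) V x
  walkToV-avoidingU x = foundWalk (λ z → ¬? (z ≟ U)) V x ∘
    from-yes (all? λ x → ¬? (x ≟ U) →-dec T? (is-just (searchWalk (λ z → ¬? (z ≟ U)) V 3 x))) x

-- Blocks are indexed by Fin (suc m); vertex U of block 0 is the hub.  For each
-- gap g : Fin m three edges join block g + 1 to the rest: hub – U and hub – V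
-- of block g + 1, and V of block g – U of block g + 1.  A Link names a dart of
-- such an edge by its ends, so vU runs from V of block g to U of block g + 1.

Vertex : ℕ → Set
Vertex m = Fin (suc m) × Fin 7

data Link : Set where
  hubU uHub hubV vHub vU uV : Link

Dart : ℕ → Set
Dart m = (Fin (suc m) × Fin 30) ⊎ (Fin m × Link)

Face : ℕ → Set
Face m = (Fin (suc m) × Fin 9) ⊎ ((Fin m × Fin 2) ⊎ Fin 1)

pattern inner i j = inj₁ (i , j)
pattern link g k  = inj₂ (g , k)

pattern blockTriangle i t = inj₁ (i , t)
pattern spineTriangle g   = inj₂ (inj₁ (g , zero))
pattern gapTriangle g     = inj₂ (inj₁ (g , suc zero))
pattern outerFace         = inj₂ (inj₂ zero)

hub : ∀ {m} → Vertex m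
hub = zero , U

nextGap : ∀ {m} → Fin m → Maybe (Fin m)
nextGap {suc zero}    zero    = nothing
nextGap {suc (suc m)} zero    = just (suc zero)
nextGap {suc (suc m)} (suc g) = Maybe.map suc (nextGap g)

nextGap-inject₁ : ∀ {m} (g : Fin m) → nextGap (inject₁ g) ≡ just (suc g)
nextGap-inject₁ {suc m}       zero    = refl
nextGap-inject₁ {suc (suc m)} (suc g) = cong (Maybe.map suc) (nextGap-inject₁ g)

nextGap-just : ∀ {m} {g g′ : Fin (suc m)} → nextGap g ≡ just g′ → ∃[ h ] (g′ ≡ suc h × inject₁ h ≡ g)
nextGap-just {suc m} {zero}  refl = zero , refl , refl
nextGap-just {suc m} {suc g} eq with nextGap g in eq′
nextGap-just {suc m} {suc g} refl | just _ with nextGap-just eq′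
... | h , refl , refl = suc h , refl , refl

nextGap-last : ∀ m → nextGap (fromℕ m) ≡ nothing
nextGap-last zero    = refl
nextGap-last (suc m) = cong (Maybe.map suc) (nextGap-last m)

tailLink : ∀ {m} → Fin m → Link → Vertex m
tailLink g hubU = hub
tailLink g uHub = suc g , U
tailLink g hubV = hub
tailLink g vHub = suc g , V
tailLink g vU   = inject₁ g , V
tailLink g uV   = suc g , U

reverseLink : Link → Link
reverseLink hubU = uHub
reverseLink uHub = hubU
reverseLink hubV = vHub
reverseLink vHub = hubV
reverseLink vU   = uV
reverseLink uV   = vU

chainTail : ∀ {m} → Dart m → Vertex m
chainTail (inner i j) = i , blockTail j
chainTail (link g k)  = tailLink g k

chainα : ∀ {m} → Dart m → Dart m
chainα (inner i j) = inner i (blockα j)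
chainα (link g k)  = link g (reverseLink k)

data Rotation : Fin 30 → Set where
  atUToW  : Rotation uToW
  atVToU  : Rotation vToU
  inBlock : ∀ {j} → Plain j → Rotation j

rotation : ∀ j → Rotation j
rotation j with j ≟ uToW | j ≟ vToU
... | yes refl | _        = atUToW
... | no _     | yes refl = atVToU
... | no j≢u   | no j≢v   = inBlock (j≢u , j≢v)

data Resumption : Fin 30 → Set where
  atUToV    : Resumption uToV
  atVToW    : Resumption vToW
  elsewhere : ∀ {j} → j ≢ uToV → j ≢ vToW → Resumption j

resumption : ∀ j → Resumption j
resumption j with j ≟ uToV | j ≟ vToW
... | yes refl | _        = atUToV
... | no _     | yes refl = atVToW
... | no j≢u   | no j≢v   = elsewhere j≢u j≢v

afterUToW : ∀ {m} → Fin (suc m) → Dart m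
afterUToW         (suc g) = link g uV
afterUToW {zero}  zero    = inner zero uToV
afterUToW {suc m} zero    = link (fromℕ m) hubV

afterVToU : ∀ {m} → Fin (suc m) → Dart m
afterVToU         (suc g) = link g vHub
afterVToU {zero}  zero    = inner zero vToW
afterVToU {suc m} zero    = link zero vU

afterVHub : ∀ {m} → Fin m → Maybe (Fin m) → Dart m
afterVHub g (just g′) = link g′ vU
afterVHub g nothing   = inner (suc g) vToW

afterHubU : ∀ {m} → Fin m → Dart m
afterHubU zero    = inner zero uToV
afterHubU (suc g) = link (inject₁ g) hubV

σInner : ∀ {m} → Fin (suc m) → ∀ {j} → Rotation j → Dart m
σInner i atUToW          = afterUToW i
σInner i atVToU          = afterVToU i
σInner i {j} (inBlock _) = inner i (blockσ j)

chainσ : ∀ {m} → Dart m → Dart m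
chainσ (inner i j)   = σInner i (rotation j)
chainσ (link g hubU) = afterHubU g
chainσ (link g uHub) = inner (suc g) uToV
chainσ (link g hubV) = link g hubU
chainσ (link g vHub) = afterVHub g (nextGap g)
chainσ (link g vU)   = inner (inject₁ g) vToW
chainσ (link g uV)   = link g uHub

beforeUToV : ∀ {m} → Fin (suc m) → Dart m
beforeUToV         (suc g) = link g uHub
beforeUToV {zero}  zero    = inner zero uToW
beforeUToV {suc m} zero    = link zero hubU

beforeVToWAt : ∀ {m} → Fin m → Maybe (Fin m) → Dart m
beforeVToWAt g (just g′) = link g′ vU
beforeVToWAt g nothing   = link g vHub

beforeVToW : ∀ {m} → Fin (suc m) → Dart m
beforeVToW         (suc g) = beforeVToWAt g (nextGap g)
beforeVToW {zero}  zero    = inner zero vToU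
beforeVToW {suc m} zero    = link zero vU

beforeHubV : ∀ {m} → Maybe (Fin m) → Dart m
beforeHubV (just g′) = link g′ hubU
beforeHubV nothing   = inner zero uToW

beforeVU : ∀ {m} → Fin m → Dart m
beforeVU zero    = inner zero vToU
beforeVU (suc h) = link (inject₁ h) vHub

σ⁻¹Inner : ∀ {m} → Fin (suc m) → ∀ {j} → Resumption j → Dart m
σ⁻¹Inner i atUToV              = beforeUToV i
σ⁻¹Inner i atVToW              = beforeVToW i
σ⁻¹Inner i {j} (elsewhere _ _) = inner i (blockσ⁻¹ j)

chainσ⁻¹ : ∀ {m} → Dart m → Dart m
chainσ⁻¹ (inner i j)   = σ⁻¹Inner i (resumption j)
chainσ⁻¹ (link g hubU) = link g hubV
chainσ⁻¹ (link g uHub) = link g uV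
chainσ⁻¹ (link g hubV) = beforeHubV (nextGap g)
chainσ⁻¹ (link g vHub) = inner (suc g) vToU
chainσ⁻¹ (link g vU)   = beforeVU g
chainσ⁻¹ (link g uV)   = inner (suc g) uToW

spineFace : ∀ {m} → Fin (suc m) → Face m
spineFace         (suc g) = spineTriangle g
spineFace {zero}  zero    = outerFace
spineFace {suc m} zero    = gapTriangle zero

faceOf : ∀ {m} → Fin (suc m) → BlockFace → Face m
faceOf i (triangle t) = blockTriangle i t
faceOf i rim          = outerFace
faceOf i spine        = spineFace i

faceAfterHubV : ∀ {m} → Maybe (Fin m) → Face m
faceAfterHubV (just g′) = gapTriangle g′
faceAfterHubV nothing   = outerFace

chainFace : ∀ {m} → Dart m → Face m
chainFace (inner i j)   = faceOf i (blockFace j)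
chainFace (link g hubU) = spineTriangle g
chainFace (link g uHub) = gapTriangle g
chainFace (link g hubV) = faceAfterHubV (nextGap g)
chainFace (link g vHub) = spineTriangle g
chainFace (link g vU)   = gapTriangle g
chainFace (link g uV)   = outerFace

chainVertexRep : ∀ {m} → Vertex m → Dart m
chainVertexRep (i , x) = inner i (blockVertexRep x)

chainFaceRep : ∀ {m} → Face m → Dart m
chainFaceRep (blockTriangle i t) = inner i (blockTriangleRep t)
chainFaceRep (spineTriangle g)   = link g hubU
chainFaceRep (gapTriangle g)     = link g uHub
chainFaceRep outerFace           = inner zero wToU

chainφ : ∀ {m} → Dart m → Dart m
chainφ = chainσ ∘ chainα

chainα-invol : ∀ {m} (x : Dart m) → chainα (chainα x) ≡ x
chainα-invol (inner i j)   = cong (inner i) (blockα-invol j)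
chainα-invol (link g hubU) = refl
chainα-invol (link g uHub) = refl
chainα-invol (link g hubV) = refl
chainα-invol (link g vHub) = refl
chainα-invol (link g vU)   = refl
chainα-invol (link g uV)   = refl

chainα-noFix : ∀ {m} (x : Dart m) → chainα x ≢ x
chainα-noFix (inner i j) eq = blockα-noFix j (cong (λ { (inner _ j) → j ; (link _ _) → j }) eq)
chainα-noFix (link g hubU) ()
chainα-noFix (link g uHub) ()
chainα-noFix (link g hubV) ()
chainα-noFix (link g vHub) ()
chainα-noFix (link g vU)   ()
chainα-noFix (link g uV)   ()

chainσ-plain : ∀ {m} (i : Fin (suc m)) j → Plain j → chainσ (inner i j) ≡ inner i (blockσ j)
chainσ-plain i j p with rotation j
... | atUToW    = ⊥-elim (proj₁ p refl)
... | atVToU    = ⊥-elim (proj₂ p refl)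
... | inBlock _ = refl

chainσ⁻¹-σ : ∀ {m} (x : Dart m) → chainσ⁻¹ (chainσ x) ≡ x
chainσ⁻¹-σ {m} (inner i j) with rotation j
chainσ⁻¹-σ {zero}  (inner zero j)    | atUToW = refl
chainσ⁻¹-σ {suc m} (inner zero j)    | atUToW rewrite nextGap-last m = refl
chainσ⁻¹-σ         (inner (suc g) j) | atUToW = refl
chainσ⁻¹-σ {zero}  (inner zero j)    | atVToU = refl
chainσ⁻¹-σ {suc m} (inner zero j)    | atVToU = refl
chainσ⁻¹-σ         (inner (suc g) j) | atVToU = refl
chainσ⁻¹-σ (inner i j) | inBlock (j≢u , j≢v) with blockσ j | blockσ⁻¹-σ j
... | j′ | back with resumption j′
...   | atUToV        = ⊥-elim (j≢u (sym back))
...   | atVToW        = ⊥-elim (j≢v (sym back))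
...   | elsewhere _ _ = cong (inner i) back
chainσ⁻¹-σ (link zero hubU)    = refl
chainσ⁻¹-σ (link (suc g) hubU) rewrite nextGap-inject₁ g = refl
chainσ⁻¹-σ (link g uHub)       = refl
chainσ⁻¹-σ (link g hubV)       = refl
chainσ⁻¹-σ {suc m} (link g vHub) with nextGap g in eq
... | nothing rewrite eq = refl
... | just g′ with nextGap-just eq
...   | h , refl , refl = refl
chainσ⁻¹-σ (link zero vU)      = refl
chainσ⁻¹-σ (link (suc h) vU) rewrite nextGap-inject₁ h = refl
chainσ⁻¹-σ (link g uV)         = refl

chainσ-tail : ∀ {m} (x : Dart m) → chainTail (chainσ x) ≡ chainTail x
chainσ-tail (inner i j) with rotation j
chainσ-tail {zero}  (inner zero j)    | atUToW = refl
chainσ-tail {suc m} (inner zero j)    | atUToW = refl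
chainσ-tail         (inner (suc g) j) | atUToW = refl
chainσ-tail {zero}  (inner zero j)    | atVToU = refl
chainσ-tail {suc m} (inner zero j)    | atVToU = refl
chainσ-tail         (inner (suc g) j) | atVToU = refl
chainσ-tail         (inner i j)       | inBlock _ = cong (i ,_) (blockσ-tail j)
chainσ-tail (link zero hubU)    = refl
chainσ-tail (link (suc g) hubU) = refl
chainσ-tail (link g uHub)       = refl
chainσ-tail (link g hubV)       = refl
chainσ-tail {suc m} (link g vHub) with nextGap g in eq
... | nothing = refl
... | just g′ with nextGap-just eq
...   | h , refl , refl = refl
chainσ-tail (link g vU)         = refl
chainσ-tail (link g uV)         = refl

reach-vertexRep-inner : ∀ {m} (i : Fin (suc m)) j →
  Reachable chainσ (inner i j) (inner i (blockVertexRep (blockTail j)))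
reach-vertexRep-inner i j with blockVertexRep-reachable j
... | k , along , reached =
  toℕ k , trans (iter-along Plain blockσ (inner i) chainσ (chainσ-plain i) (toℕ k) j along) (cong (inner i) reached)

-- The hub's rotation runs down the gaps: hubU (g + 1) ⟶ hubV g ⟶ hubU g ⟶ … ⟶ U → V of block 0.
reach-hub : ∀ {m} k (g : Fin m) → toℕ g ≡ k → Reachable chainσ (link g hubU) (inner zero uToV)
reach-hub k       zero    _  = 1 , refl
reach-hub (suc k) (suc g) eq = reachable-step chainσ (reachable-step chainσ
  (reach-hub k (inject₁ g) (trans (toℕ-inject₁ g) (suc-injective eq))))

chain-vertexRep-reachable : ∀ {m} (x : Dart m) → Reachable chainσ x (chainVertexRep (chainTail x))
chain-vertexRep-reachable (inner i j)   = reach-vertexRep-inner i j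
chain-vertexRep-reachable (link g hubU) = reachable-trans chainσ (reach-hub _ g refl) (reach-vertexRep-inner zero uToV)
chain-vertexRep-reachable (link g hubV) = reachable-step chainσ (chain-vertexRep-reachable (link g hubU))
chain-vertexRep-reachable (link g uHub) = reachable-step chainσ (reach-vertexRep-inner (suc g) uToV)
chain-vertexRep-reachable (link g uV)   = reachable-step chainσ (chain-vertexRep-reachable (link g uHub))
chain-vertexRep-reachable {suc m} (link g vHub) = reachable-step chainσ (afterVHub-reaches (nextGap g) refl)
  where
  afterVHub-reaches : ∀ r → nextGap g ≡ r → Reachable chainσ (afterVHub g r) (inner (suc g) (blockVertexRep V))
  afterVHub-reaches nothing   _  = reach-vertexRep-inner (suc g) vToW
  afterVHub-reaches (just g′) eq with nextGap-just eq
  ... | h , refl , refl = reachable-step chainσ (reach-vertexRep-inner (suc (inject₁ h)) vToW)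
chain-vertexRep-reachable (link g vU)   = reachable-step chainσ (reach-vertexRep-inner (inject₁ g) vToW)

chainFace-φ-inner : ∀ {m} (i : Fin (suc m)) j → chainFace (chainσ (inner i j)) ≡ faceOf i (blockFace (blockα j))
chainFace-φ-inner i j with rotation j
chainFace-φ-inner         (suc g) j | atUToW = refl
chainFace-φ-inner {zero}  zero    j | atUToW = refl
chainFace-φ-inner {suc m} zero    j | atUToW rewrite nextGap-last m = refl
chainFace-φ-inner         (suc g) j | atVToU = refl
chainFace-φ-inner {zero}  zero    j | atVToU = refl
chainFace-φ-inner {suc m} zero    j | atVToU = refl
chainFace-φ-inner i j | inBlock p =
  cong (faceOf i) (trans (cong (blockFace ∘ blockσ) (sym (blockα-invol j)))
                         (blockFace-φ (blockα j) (subst Plain (sym (blockα-invol j)) p)))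

chainFace-φ : ∀ {m} (x : Dart m) → chainFace (chainφ x) ≡ chainFace x
chainFace-φ (inner i j) = trans (chainFace-φ-inner i (blockα j)) (cong (faceOf i ∘ blockFace) (blockα-invol j))
chainFace-φ (link g hubU)          = refl
chainFace-φ (link zero uHub)       = refl
chainFace-φ (link (suc g) uHub) rewrite nextGap-inject₁ g = refl
chainFace-φ (link g hubV) with nextGap g
... | just _  = refl
... | nothing = refl
chainFace-φ (link g vHub)          = refl
chainFace-φ (link g vU)            = refl
chainFace-φ (link g uV)            = refl

chainφ-plain : ∀ {m} (i : Fin (suc m)) j → Plain (blockα j) → chainφ (inner i j) ≡ inner i (blockφ j)
chainφ-plain i j = chainσ-plain i (blockα j)

-- The outer face runs W → U of block g + 1, U → V across the gap, V → W and W → U of block g.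
reach-outer : ∀ {m} k (i : Fin (suc m)) → toℕ i ≡ k → Reachable chainφ (inner i wToU) (inner zero wToU)
reach-outer k       zero    _  = reachable-refl chainφ
reach-outer (suc k) (suc g) eq = reachable-step chainφ (reachable-step chainφ (reachable-step chainφ
  (reach-outer k (inject₁ g) (trans (toℕ-inject₁ g) (suc-injective eq)))))

chain-faceRep-reachable-inner : ∀ {m} (i : Fin (suc m)) j →
  Reachable chainφ (inner i j) (chainFaceRep (faceOf i (blockFace j)))
chain-faceRep-reachable-inner i j with blockFace j in eq
... | triangle t with blockTriangleRep-reachable j t eq
...   | k , along , reached =
  toℕ k , trans (iter-along (Plain ∘ blockα) blockφ (inner i) chainφ (chainφ-plain i) (toℕ k) j along)
                (cong (inner i) reached)
chain-faceRep-reachable-inner i j | rim with rim-darts j eq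
... | inj₁ refl = reachable-step chainφ (reach-outer _ i refl)
... | inj₂ refl = reach-outer _ i refl
chain-faceRep-reachable-inner i j | spine with spine-dart j eq
... | refl = reach-spine i
  where
  reach-spine : ∀ {m} (i : Fin (suc m)) → Reachable chainφ (inner i uToV) (chainFaceRep (spineFace i))
  reach-spine         (suc g) = 2 , refl
  reach-spine {zero}  zero    = 2 , refl
  reach-spine {suc m} zero    = 2 , refl

chain-faceRep-reachable : ∀ {m} (x : Dart m) → Reachable chainφ x (chainFaceRep (chainFace x))
chain-faceRep-reachable (inner i j)   = chain-faceRep-reachable-inner i j
chain-faceRep-reachable (link g hubU) = reachable-refl chainφ
chain-faceRep-reachable (link g uHub) = reachable-refl chainφ
chain-faceRep-reachable (link g vHub) = 1 , refl
chain-faceRep-reachable (link g vU)   = 1 , refl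
chain-faceRep-reachable (link g uV)   = reachable-step chainφ (reachable-step chainφ (reach-outer _ (inject₁ g) refl))
chain-faceRep-reachable {suc m} (link g hubV) = reachable-step chainφ (afterVHub-reaches (nextGap g))
  where
  afterVHub-reaches : ∀ r → Reachable chainφ (afterVHub g r) (chainFaceRep (faceAfterHubV r))
  afterVHub-reaches (just g′) = 1 , refl
  afterVHub-reaches nothing   = reachable-step chainφ (reach-outer _ (suc g) refl)

chainFace-faceRep : ∀ {m} (F : Face m) → chainFace (chainFaceRep F) ≡ F
chainFace-faceRep (blockTriangle i t) = cong (faceOf i) (blockFace-triangleRep t)
chainFace-faceRep (spineTriangle g)   = refl
chainFace-faceRep (gapTriangle g)     = refl
chainFace-faceRep outerFace           = refl

chain-triangles : ∀ {m} (F : Face m) → F ≢ outerFace → iter chainφ 3 (chainFaceRep F) ≡ chainFaceRep F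
chain-triangles (blockTriangle i t) _ with blockTriangle-cycle t
... | along , cycle =
  trans (iter-along (Plain ∘ blockα) blockφ (inner i) chainφ (chainφ-plain i) 3 (blockTriangleRep t) along)
        (cong (inner i) cycle)
chain-triangles (spineTriangle g)      _ = refl
chain-triangles (gapTriangle zero)     _ = refl
chain-triangles (gapTriangle (suc g))  _ rewrite nextGap-inject₁ g = refl
chain-triangles outerFace              F≢outer = ⊥-elim (F≢outer refl)

chainNoLoop : ∀ {m} (x : Dart m) → chainTail (chainα x) ≢ chainTail x
chainNoLoop (inner i j) eq = blockNoLoop j (cong proj₂ eq)
chainNoLoop (link g hubU) ()
chainNoLoop (link g uHub) ()
chainNoLoop (link g hubV) ()
chainNoLoop (link g vHub) ()
chainNoLoop (link g vU)   ()
chainNoLoop (link g uV)   ()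

link-ends : ∀ {m} (g : Fin m) k → proj₂ (tailLink g k) ≡ U ⊎ proj₂ (tailLink g k) ≡ V
link-ends g hubU = inj₁ refl
link-ends g uHub = inj₁ refl
link-ends g hubV = inj₁ refl
link-ends g vHub = inj₂ refl
link-ends g vU   = inj₂ refl
link-ends g uV   = inj₁ refl

inject₁≢suc : ∀ {m} (g : Fin m) → inject₁ g ≢ suc g
inject₁≢suc g eq = 1+n≢n (sym (trans (sym (toℕ-inject₁ g)) (cong toℕ eq)))

link-crosses : ∀ {m} (g : Fin m) k → proj₁ (tailLink g k) ≢ proj₁ (tailLink g (reverseLink k))
link-crosses g hubU ()
link-crosses g uHub ()
link-crosses g hubV ()
link-crosses g vHub ()
link-crosses g vU   = inject₁≢suc g
link-crosses g uV   = inject₁≢suc g ∘ sym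

linkNoMulti : ∀ {m} (g g′ : Fin m) k k′ → tailLink g k ≡ tailLink g′ k′ →
  tailLink g (reverseLink k) ≡ tailLink g′ (reverseLink k′) → (g , k) ≡ (g′ , k′)
linkNoMulti g g′ hubU hubU _    refl = refl
linkNoMulti g g′ uHub uHub refl _    = refl
linkNoMulti g g′ hubV hubV _    refl = refl
linkNoMulti g g′ vHub vHub refl _    = refl
linkNoMulti g g′ vU   vU   _    refl = refl
linkNoMulti g g′ uV   uV   refl _    = refl
linkNoMulti g g′ hubU uHub ()   _
linkNoMulti g g′ hubU hubV _    ()
linkNoMulti g g′ hubU vHub ()   _
linkNoMulti g g′ hubU vU   ()   _
linkNoMulti g g′ hubU uV   ()   _
linkNoMulti g g′ uHub hubU ()   _
linkNoMulti g g′ uHub hubV ()   _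
linkNoMulti g g′ uHub vHub ()   _
linkNoMulti g g′ uHub vU   ()   _
linkNoMulti g g′ uHub uV   _    ()
linkNoMulti g g′ hubV hubU _    ()
linkNoMulti g g′ hubV uHub ()   _
linkNoMulti g g′ hubV vHub ()   _
linkNoMulti g g′ hubV vU   ()   _
linkNoMulti g g′ hubV uV   ()   _
linkNoMulti g g′ vHub hubU ()   _
linkNoMulti g g′ vHub uHub ()   _
linkNoMulti g g′ vHub hubV ()   _
linkNoMulti g g′ vHub vU   _    ()
linkNoMulti g g′ vHub uV   ()   _
linkNoMulti g g′ vU   hubU ()   _
linkNoMulti g g′ vU   uHub ()   _
linkNoMulti g g′ vU   hubV ()   _
linkNoMulti g g′ vU   vHub _    ()
linkNoMulti g g′ vU   uV   ()   _
linkNoMulti g g′ uV   hubU ()   _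
linkNoMulti g g′ uV   uHub _    ()
linkNoMulti g g′ uV   hubV ()   _
linkNoMulti g g′ uV   vHub ()   _
linkNoMulti g g′ uV   vU   ()   _

chainNoMulti : ∀ {m} (x y : Dart m) → chainTail x ≡ chainTail y →
  chainTail (chainα x) ≡ chainTail (chainα y) → x ≡ y
chainNoMulti (inner i j) (inner i′ j′) eq eqα with cong proj₁ eq
... | refl = cong (inner i) (blockNoMulti j j′ (cong proj₂ eq) (cong proj₂ eqα))
chainNoMulti (link g k)  (link g′ k′) eq eqα = cong inj₂ (linkNoMulti g g′ k k′ eq eqα)
chainNoMulti (inner i j) (link g k)   eq eqα =
  ⊥-elim (link-crosses g k (trans (sym (cong proj₁ eq)) (cong proj₁ eqα)))
chainNoMulti (link g k)  (inner i j)  eq eqα =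
  ⊥-elim (link-crosses g k (trans (cong proj₁ eq) (sym (cong proj₁ eqα))))

chainMap : ∀ m → PlaneMap (Vertex m) (Dart m) (Face m)
chainMap m = record
  { tail = chainTail ; α = chainα ; σ = chainσ ; σ⁻¹ = chainσ⁻¹ ; face = chainFace ; outer = outerFace
  ; vertexRep = chainVertexRep ; faceRep = chainFaceRep
  ; α-invol = chainα-invol ; α-noFix = chainα-noFix ; σ⁻¹-σ = chainσ⁻¹-σ ; σ-tail = chainσ-tail
  ; vertexRep-reachable = chain-vertexRep-reachable
  ; face-φ = chainFace-φ ; faceRep-reachable = chain-faceRep-reachable ; face-faceRep = chainFace-faceRep
  ; noLoop = chainNoLoop ; noMulti = chainNoMulti
  }

Link↔ : Fin 6 ↔ Link
Link↔ = mk↔ₛ′ to from to-from from-to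
  where
  to : Fin 6 → Link
  to zero                               = hubU
  to (suc zero)                         = uHub
  to (suc (suc zero))                   = hubV
  to (suc (suc (suc zero)))             = vHub
  to (suc (suc (suc (suc zero))))       = vU
  to (suc (suc (suc (suc (suc zero))))) = uV
  from : Link → Fin 6
  from hubU = zero
  from uHub = suc zero
  from hubV = suc (suc zero)
  from vHub = suc (suc (suc zero))
  from vU   = suc (suc (suc (suc zero)))
  from uV   = suc (suc (suc (suc (suc zero))))
  to-from : ∀ k → to (from k) ≡ k
  to-from hubU = refl
  to-from uHub = refl
  to-from hubV = refl
  to-from vHub = refl
  to-from vU   = refl
  to-from uV   = refl
  from-to : ∀ i → from (to i) ≡ i
  from-to zero                               = refl
  from-to (suc zero)                         = refl
  from-to (suc (suc zero))                   = refl
  from-to (suc (suc (suc zero)))             = refl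
  from-to (suc (suc (suc (suc zero))))       = refl
  from-to (suc (suc (suc (suc (suc zero))))) = refl

chain-euler : ∀ m → 2 * (suc m * 7) + 2 * (suc m * 9 + (m * 2 + 1)) ≡ 4 + (suc m * 30 + m * 6)
chain-euler = solve-∀

module _ (m : ℕ) where

  Vertex↔ : Fin (suc m * 7) ↔ Vertex m
  Vertex↔ = *↔×

  Dart↔ : Fin (suc m * 30 + m * 6) ↔ Dart m
  Dart↔ = ↔-trans +↔⊎ (*↔× ⊎-↔ ↔-trans *↔× (↔-refl ×-↔ Link↔))

  Face↔ : Fin (suc m * 9 + (m * 2 + 1)) ↔ Face m
  Face↔ = ↔-trans +↔⊎ (*↔× ⊎-↔ ↔-trans +↔⊎ (*↔× ⊎-↔ ↔-refl))

  open Enumerated (chainMap m) Vertex↔ Dart↔ Face↔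

  chainGraph : PlaneGraph
  chainGraph = toPlaneGraph (chain-euler m)

  private
    G = chainGraph
    n = suc m * 7
    euler = chain-euler m

  localDegree≤deg : ∀ v → localDegree (proj₂ (vertexAt v)) ≤ deg G v
  localDegree≤deg v = subst (λ v′ → localDegree x ≤ deg G v′) (index-vertexAt v)
    (subst (_≤ deg G (vertexIndex (i , x))) (length-map innerAt atX-darts)
      (darts≤deg euler (map⁺ innerAt-injective (filter⁺ atX (allFin⁺ 30)))
        (All.map⁺ (All.map (cong (i ,_)) (all-filter atX (allFin 30))))))
    where
    i = proj₁ (vertexAt v)
    x = proj₂ (vertexAt v)
    atX = λ j → blockTail j ≟ x
    atX-darts = filter atX (allFin 30)
    innerAt : Fin 30 → Dart m
    innerAt j = inner i j
    innerAt-injective : ∀ {j j′} → innerAt j ≡ innerAt j′ → j ≡ j′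
    innerAt-injective refl = refl

  3≤deg : ∀ v → 3 ≤ deg G v
  3≤deg v = ≤-trans (3≤localDegree (proj₂ (vertexAt v))) (localDegree≤deg v)

  deg≡3⇒W : ∀ v → deg G v ≡ 3 → proj₂ (vertexAt v) ≡ W
  deg≡3⇒W v deg≡3 with proj₂ (vertexAt v) ≟ W
  ... | yes isW = isW
  ... | no notW = ⊥-elim (<⇒≱ (s≤s ≤-refl)
    (subst (4 ≤_) deg≡3 (≤-trans (4≤localDegree (proj₂ (vertexAt v)) notW) (localDegree≤deg v))))

  W-edge-free : ∀ (d : Dart m) → proj₂ (chainTail d) ≡ W → proj₂ (chainTail (chainα d)) ≢ W
  W-edge-free (inner i j) = W-independent j
  W-edge-free (link g k) tailW _ with link-ends g k
  ... | inj₁ isU with trans (sym isU) tailW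
  ...   | ()
  W-edge-free (link g k) tailW _ | inj₂ isV with trans (sym isV) tailW
  ...   | ()

  chain-noBadFiveWheel : ¬ BadFiveWheel G
  chain-noBadFiveWheel (_ , a , b , _ , _ , _ , (a~b , _) , _ , (_ , deg-a , _ , deg-b)) =
    let (d , tail≡a , head≡b) = Adj⇒dart euler a~b in
    W-edge-free d (trans (cong proj₂ tail≡a) (deg≡3⇒W a deg-a)) (trans (cong proj₂ head≡b) (deg≡3⇒W b deg-b))

  chainDominator : Subset n
  chainDominator = concat (replicate (suc m) blockDominator)

  chainDominator-dominates : Dominating G chainDominator
  chainDominator-dominates v =
    subst (λ v′ → v′ ∈ chainDominator ⊎ ∃[ u ] (u ∈ chainDominator × Adj G u v′)) (index-vertexAt v)
      (dominate (proj₁ (vertexAt v)) (proj₂ (vertexAt v)))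
    where
    member : ∀ i x → x ∈ blockDominator → vertexIndex (i , x) ∈ chainDominator
    member i x x∈ = ∈-concat⁺ (replicate (suc m) blockDominator) i x
                      (subst (x ∈_) (sym (lookup-replicate i blockDominator)) x∈)
    dominate : ∀ i y → vertexIndex (i , y) ∈ chainDominator ⊎
                       ∃[ u ] (u ∈ chainDominator × Adj G u (vertexIndex (i , y)))
    dominate i y with blockDominator-dominates y
    ... | x , x∈ , inj₁ refl = inj₁ (member i x x∈)
    ... | x , x∈ , inj₂ (j , refl , refl) = inj₂ (vertexIndex (i , x) , member i x x∈ , Adj-dart euler (inner i j))

  interior-dominated : ∀ ps → Dominating G (concat ps) → ∀ i y → Interior y → DominatesInBlock (lookup ps i) y
  interior-dominated ps dom i y (y≢U , y≢V) with dom (vertexIndex (i , y))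
  ... | inj₁ iy∈ = y , ∈-concat⁻ ps i y iy∈ , inj₁ refl
  ... | inj₂ (u , u∈ , u~iy) =
    let (d , tail≡u , head≡iy) = Adj⇒dart euler u~iy in
    from-dart d tail≡u (trans head≡iy (vertexAt-index (i , y)))
    where
    from-dart : ∀ d → chainTail d ≡ vertexAt u → chainTail (chainα d) ≡ (i , y) →
      DominatesInBlock (lookup ps i) y
    from-dart (inner i′ j) tail≡u refl = blockTail j , ∈-concat⁻ ps i (blockTail j) ij∈ , inj₂ (j , refl , refl)
      where
      ij∈ : vertexIndex (i , blockTail j) ∈ concat ps
      ij∈ = subst (_∈ concat ps) (trans (sym (index-vertexAt u)) (cong vertexIndex (sym tail≡u))) u∈
    from-dart (link g k) _ head≡iy with link-ends g (reverseLink k)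
    ... | inj₁ isU = ⊥-elim (y≢U (trans (sym (cong proj₂ head≡iy)) isU))
    ... | inj₂ isV = ⊥-elim (y≢V (trans (sym (cong proj₂ head≡iy)) isV))

  chain-dominationNumber : IsDominationNumber G (suc m * 2)
  chain-dominationNumber =
    (chainDominator , chainDominator-dominates , ∣concat-replicate∣ (suc m) blockDominator) ,
    λ S dom → let (ps , S≡ps) = group (suc m) 7 S in
      subst (λ S′ → suc m * 2 ≤ ∣ S′ ∣) (sym S≡ps)
        (*≤∣concat∣ ps λ i → interior-domination-needs-two (lookup ps i)
          (interior-dominated ps (subst (Dominating G) S≡ps dom) i))

  Avoids : Vertex m → Fin n → Set
  Avoids w z = vertexAt z ≢ w

  avoids : ∀ {w a} → a ≢ w → Avoids w (vertexIndex a)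
  avoids {w} {a} a≢w eq = a≢w (trans (sym (vertexAt-index a)) eq)

  liftBlockWalk : ∀ {P : Fin n → Set} i {Ok : Fin 7 → Set} {y x} → (∀ {z} → Ok z → P (vertexIndex (i , z))) →
    P (vertexIndex (i , x)) → BlockWalk Ok y x → Walk G P (vertexIndex (i , x)) (vertexIndex (i , y))
  liftBlockWalk i ok⇒P Px arrived          = here Px
  liftBlockWalk i ok⇒P Px (via j ok rest) = step Px (Adj-dart euler (inner i j)) (liftBlockWalk i ok⇒P (ok⇒P ok) rest)

  _≟ᵛ_ : (a b : Vertex m) → Dec (a ≡ b)
  _≟ᵛ_ = ≡-dec _≟_ _≟_

  walkToU-within : ∀ w i x → (i , x) ≢ w → (i , U) ≢ w →
    Walk G (Avoids w) (vertexIndex (i , x)) (vertexIndex (i , U))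
  walkToU-within (b , r) i x x≢w U≢w = byBlock (i ≟ b)
    where
    byBlock : Dec (i ≡ b) → Walk G (Avoids (b , r)) (vertexIndex (i , x)) (vertexIndex (i , U))
    byBlock (yes refl) = liftBlockWalk i (λ {z} z≢r → avoids {a = i , z} (z≢r ∘ cong proj₂)) (avoids x≢w)
                           (walkToU-avoiding r x (λ r≡U → U≢w (cong (i ,_) (sym r≡U))) (x≢w ∘ cong (i ,_)))
    byBlock (no i≢b)   = liftBlockWalk i (λ _ → avoids (i≢b ∘ cong proj₁)) (avoids x≢w) (walkToU x)

  -- Every block reaches the hub through its U or, if U is removed, through its V.
  walkToHub : ∀ w → w ≢ hub → ∀ i x → (i , x) ≢ w → Walk G (Avoids w) (vertexIndex (i , x)) (vertexIndex hub)
  walkToHub w w≢hub zero    x x≢w = walkToU-within w zero x x≢w (w≢hub ∘ sym)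
  walkToHub w w≢hub (suc g) x x≢w = byU ((suc g , U) ≟ᵛ w)
    where
    byU : Dec ((suc g , U) ≡ w) → Walk G (Avoids w) (vertexIndex (suc g , x)) (vertexIndex hub)
    byU (no U≢w)   = walkToU-within w (suc g) x x≢w U≢w ++ʷ
                       step (avoids U≢w) (Adj-dart euler (link g uHub)) (here (avoids (w≢hub ∘ sym)))
    byU (yes refl) = liftBlockWalk (suc g) (λ {z} z≢U → avoids {a = suc g , z} (z≢U ∘ cong proj₂)) (avoids x≢w)
                       (walkToV-avoidingU x (x≢w ∘ cong (suc g ,_))) ++ʷ
                       step (avoids {a = suc g , V} (λ ())) (Adj-dart euler (link g vHub)) (here (avoids (w≢hub ∘ sym)))

  -- Without the hub, block g + 1 reaches block g through the link U → V.
  walkToV₀ : ∀ k i x → toℕ i ≡ k → (i , x) ≢ hub →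
    Walk G (Avoids hub) (vertexIndex (i , x)) (vertexIndex (zero , V))
  walkToV₀ _       zero    x _  x≢hub =
    liftBlockWalk zero (λ {z} z≢U → avoids {a = zero , z} (z≢U ∘ cong proj₂)) (avoids x≢hub)
      (walkToV-avoidingU x (x≢hub ∘ cong (zero ,_)))
  walkToV₀ (suc k) (suc g) x eq _     = liftBlockWalk (suc g) (λ {z} _ → off-hub z) (off-hub x) (walkToU x) ++ʷ
    step (off-hub U) (Adj-dart euler (link g uV))
      (walkToV₀ k (inject₁ g) V (trans (toℕ-inject₁ g) (suc-injective eq)) ((λ ()) ∘ cong proj₂))
    where
    off-hub : ∀ z → Avoids hub (vertexIndex (suc g , z))
    off-hub z = avoids {a = suc g , z} (λ ())

  avoidingWalk : ∀ w a b → a ≢ w → b ≢ w → Walk G (Avoids w) (vertexIndex a) (vertexIndex b)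
  avoidingWalk w (i , x) (i′ , x′) a≢w b≢w = byHub (w ≟ᵛ hub)
    where
    byHub : Dec (w ≡ hub) → Walk G (Avoids w) (vertexIndex (i , x)) (vertexIndex (i′ , x′))
    byHub (no w≢hub) = walkToHub w w≢hub i x a≢w ++ʷ reverseʷ (walkToHub w w≢hub i′ x′ b≢w)
    byHub (yes refl) = walkToV₀ _ i x refl a≢w ++ʷ reverseʷ (walkToV₀ _ i′ x′ refl b≢w)

  chain-avoidingWalks : AvoidingWalks G
  chain-avoidingWalks w u v u≢w v≢w =
    subst₂ (Walk G (_≢ w)) (index-vertexAt u) (index-vertexAt v)
      (mapʷ (λ {z} z≁w z≡w → z≁w (cong vertexAt z≡w))
        (avoidingWalk (vertexAt w) (vertexAt u) (vertexAt v) (vertexAt-≢ u≢w) (vertexAt-≢ v≢w)))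
    where
    vertexAt-≢ : ∀ {a b} → a ≢ b → vertexAt a ≢ vertexAt b
    vertexAt-≢ {a} {b} a≢b eq = a≢b (trans (sym (index-vertexAt a)) (trans (cong vertexIndex eq) (index-vertexAt b)))

  chain-nearTriangulation : NearTriangulation G
  chain-nearTriangulation =
    twoConnected G (s≤s (s≤s (s≤s z≤n))) chain-avoidingWalks , triangulated euler chain-triangles

  chain-deg≢2 : ∀ v → deg G v ≢ 2
  chain-deg≢2 v deg≡2 = <⇒≱ (s≤s (s≤s ≤-refl)) (subst (3 ≤_) deg≡2 (3≤deg v))

mainTheorem8 : (N : ℕ) → Σ PlaneGraph λ G → N ≤ PlaneGraph.n G × NearTriangulation G × (∀ v → deg G v ≢ 2) × ¬ BadFiveWheel G × Σ ℕ λ k → IsDominationNumber G k × 7 * k ≡ 2 * PlaneGraph.n G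
mainTheorem8 N =
  chainGraph N , N≤7[N+1] , chain-nearTriangulation N , chain-deg≢2 N , chain-noBadFiveWheel N ,
  suc N * 2 , chain-dominationNumber N , ratio N
  where
  N≤7[N+1] : N ≤ suc N * 7
  N≤7[N+1] = ≤-trans (n≤1+n N) (m≤m*n (suc N) 7)
  ratio : ∀ N → 7 * (suc N * 2) ≡ 2 * (suc N * 7)
  ratio = solve-∀
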